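{- Let $\mathbf A$ be a t-algebra of type $\tau$ and trace $\mathsf a$, $X$ an infinite set disjoint from $\tau$, and $u_1,u_2$ $\tau$-hyperterms over $X$. Then $\mathbf A$ weakly satisfies $u_1=u_2$ if and only if $\mathbf A$ strongly satisfies $u_1=u_2$.
   Context: $\mathbb N=\{1,2,\dots\}$. Threads on $A$: elements of $A^{\mathbb N}$; $r[a_1,..,a_n]$ replaces the first $n$ entries of $r$. $r\equiv_{\mathbb N}s$ iff they differ in finitely many entries. A trace on $A$: nonempty union of $\equiv_{\mathbb N}$-classes. A t-algebra of type $\tau$, trace $\mathsf a$: $(A,\mathsf a,\sigma^{\mathbf A})_{\sigma\in\tau}$ with $\sigma^{\mathbf A}:\mathsf a\to A$. A map $\varphi:\mathsf a\to A$ is semiconstant if $\varphi(r)=\varphi(s)$ whenever $r\equiv_{\mathbb N}s$. $\tau$-hyperterms over $X$: $\mathsf e_i$ ($i\ge1$), and $w(t_1,..,t_n,\mathsf e_{n+1},\mathsf e_{n+2},..)$ for $w\in\tau\cup X$, $n\ge0$, hyperterms $t_1,..,t_n$. For any map $h$ from $X$ to the set of maps $\mathsf a\to A$, define $h^*(u):\mathsf a\to A$ by $h^*(\mathsf e_i)(s)=s_i$, $h^*(\sigma(t_1,..,t_n,\mathsf e_{n+1},..))(s)=\sigma^{\mathbf A}(s[h^*(t_1)(s),..,h^*(t_n)(s)])$, $h^*(x(t_1,..,t_n,\mathsf e_{n+1},..))(s)=h(x)(s[h^*(t_1)(s),..,h^*(t_n)(s)])$ (these $h^*$ are exactly the homomorphisms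 of clone $\tau$-algebras from the hyperterm algebra into the full functional clone $\tau$-algebra on $\mathbf A$). $\mathbf A$ weakly (resp. strongly) satisfies $u_1=u_2$ if $h^*(u_1)=h^*(u_2)$ for every $h$ such that each $h(x)$ is constant (resp. semiconstant). -}

module Defs where

open import Data.Nat using (ℕ; zero; suc; _≤_; z≤n; s≤s)
open import Data.List using (List; []; _∷_; length)
open import Data.Product using (Σ; ∃; _,_; proj₁; proj₂)
open import Data.Sum using (_⊎_; inj₁; inj₂)
open import Relation.Binary.PropositionalEquality using (_≡_; refl; sym; trans)
open import Function.Definitions using (Injective)

-- Threads on A.  Index 0 here corresponds to the paper's index 1
-- (entry i of the paper is entry (i - 1) here).
Thread : Set → Set
Thread A = ℕ → A

replace : {A : Set} → List A → Thread A → Thread A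
replace []       r i       = r i
replace (x ∷ xs) r zero    = x
replace (x ∷ xs) r (suc i) = replace xs (λ j → r (suc j)) i

_≡ℕ_ : {A : Set} → Thread A → Thread A → Set
r ≡ℕ s = ∃ λ N → ∀ i → N ≤ i → r i ≡ s i

replace-≡ℕ : {A : Set} (xs : List A) (r : Thread A) → r ≡ℕ replace xs r
replace-≡ℕ xs r = length xs , go xs r
  where
  go : ∀ {A : Set} (xs : List A) (r : Thread A) (i : ℕ) → length xs ≤ i → r i ≡ replace xs r i
  go []       r i       _         = refl
  go (x ∷ xs) r (suc i) (s≤s le) = go xs (λ j → r (suc j)) i le

-- A trace on A: a nonempty union of ≡ℕ-classes, i.e. a nonempty set of
-- threads closed under ≡ℕ.
record Trace (A : Set) : Set₁ where
  field
    mem      : Thread A → Set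
    nonempty : ∃ λ s → mem s
    closed   : ∀ r s → r ≡ℕ s → mem r → mem s

-- Maps 𝖺 → A (membership proof is irrelevant, so the map depends only on the thread).
Map : {A : Set} → Trace A → Set
Map {A} a = (s : Thread A) → .(Trace.mem a s) → A

record TAlgebra (τ : Set) : Set₁ where
  field
    Carrier : Set
    trace   : Trace Carrier
    op      : τ → Map trace

Constant : {A : Set} {a : Trace A} → Map a → Set
Constant {A} {a} φ = ∀ r s .(pr : Trace.mem a r) .(ps : Trace.mem a s) → φ r pr ≡ φ s ps

Semiconstant : {A : Set} {a : Trace A} → Map a → Set
Semiconstant {A} {a} φ =
  ∀ r s .(pr : Trace.mem a r) .(ps : Trace.mem a s) → r ≡ℕ s → φ r pr ≡ φ s ps

-- τ-hyperterms over X.  (e i) is the paper's 𝖾_{i+1};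
-- (app w (t₁ ∷ … ∷ tₙ ∷ [])) is w(t₁,…,tₙ,𝖾_{n+1},𝖾_{n+2},…) for w ∈ τ ∪ X
-- (the disjoint union τ ⊎ X encodes that X is disjoint from τ).
data HTerm (τ X : Set) : Set where
  e   : ℕ → HTerm τ X
  app : τ ⊎ X → List (HTerm τ X) → HTerm τ X

module _ {τ X : Set} (𝐀 : TAlgebra τ) where
  open TAlgebra 𝐀

  private
    head-sym : τ ⊎ X → (X → Map trace) → Map trace
    head-sym (inj₁ σ) h = op σ
    head-sym (inj₂ x) h = h x

  mutual
    eval : (X → Map trace) → HTerm τ X → Map trace
    eval h (e i)      s p = s i
    eval h (app w ts) s p =
      head-sym w h (replace (evalList h ts s p) s)
        (Trace.closed trace s _ (replace-≡ℕ (evalList h ts s p) s) p)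

    evalList : (X → Map trace) → List (HTerm τ X) → (s : Thread Carrier) → .(Trace.mem trace s) → List Carrier
    evalList h []       s p = []
    evalList h (t ∷ ts) s p = eval h t s p ∷ evalList h ts s p

  EqMap : Map trace → Map trace → Set
  EqMap φ ψ = ∀ s .(p : Trace.mem trace s) → φ s p ≡ ψ s p

  WeaklySatisfies : HTerm τ X → HTerm τ X → Set
  WeaklySatisfies u₁ u₂ =
    (h : X → Map trace) → (∀ x → Constant {a = trace} (h x)) → EqMap (eval h u₁) (eval h u₂)

  StronglySatisfies : HTerm τ X → HTerm τ X → Set
  StronglySatisfies u₁ u₂ =
    (h : X → Map trace) → (∀ x → Semiconstant {a = trace} (h x)) → EqMap (eval h u₁) (eval h u₂)

Infinite : Set → Set
Infinite X = Σ (ℕ → X) (λ f → Injective _≡_ _≡_ f)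

{-# OPTIONS --safe #-}
module Submission where

-- Strong satisfaction implies weak satisfaction because constant maps are
-- semiconstant.  Conversely, given semiconstant h and a thread s, replace h
-- by the constant assignment x ↦ h x s.  Every thread at which h* consults
-- some h x is obtained from s by rewriting finitely many entries, so
-- semiconstancy makes h and its frozen version agree there; hence h*(u) and
-- the frozen evaluation coincide at s for every hyperterm u, and weak
-- satisfaction transfers.

open import Defs
open import Data.Product using (_×_; _,_)
open import Data.Sum using (inj₁; inj₂)
open import Data.Nat using (_⊔_)
open import Data.Nat.Properties using (m≤m⊔n; m≤n⊔m; ≤-trans)
open import Data.List using (List; []; _∷_)
open import Relation.Binary.PropositionalEquality using (_≡_; refl; sym; trans; cong; cong₂; module ≡-Reasoning)

≡ℕ-refl : {A : Set} {r : Thread A} → r ≡ℕ r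
≡ℕ-refl = 0 , λ _ _ → refl

≡ℕ-trans : {A : Set} {r s t : Thread A} → r ≡ℕ s → s ≡ℕ t → r ≡ℕ t
≡ℕ-trans (M , r≈s) (N , s≈t) = M ⊔ N , λ i M⊔N≤i →
  trans (r≈s i (≤-trans (m≤m⊔n M N) M⊔N≤i)) (s≈t i (≤-trans (m≤n⊔m M N) M⊔N≤i))

constant⇒semiconstant : {A : Set} {a : Trace A} {φ : Map a} → Constant {a = a} φ → Semiconstant {a = a} φ
constant⇒semiconstant φ-const r s pr ps _ = φ-const r s pr ps

module _ {τ X : Set} (𝐀 : TAlgebra τ) where
  open TAlgebra 𝐀

  freeze : (X → Map trace) → (s : Thread Carrier) → .(Trace.mem trace s) → X → Map trace
  freeze h s p x _ _ = h x s p

  freeze-constant : (h : X → Map trace) (s : Thread Carrier) .(p : Trace.mem trace s) →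
                    ∀ x → Constant {a = trace} (freeze h s p x)
  freeze-constant _ _ _ _ _ _ _ _ = refl

  module _ (h : X → Map trace) (h-semiconst : ∀ x → Semiconstant {a = trace} (h x))
           (s : Thread Carrier) .(p : Trace.mem trace s) where

    mutual
      eval-freeze : (u : HTerm τ X) (r : Thread Carrier) .(pr : Trace.mem trace r) → s ≡ℕ r →
                    eval 𝐀 h u r pr ≡ eval 𝐀 (freeze h s p) u r pr
      eval-freeze (e i)             r pr s≈r = refl
      eval-freeze (app (inj₁ σ) ts) r pr s≈r =
        cong (λ as → op σ (replace as r) (Trace.closed trace r _ (replace-≡ℕ as r) pr))
             (evalList-freeze ts r pr s≈r)
      eval-freeze (app (inj₂ x) ts) r pr s≈r =
        sym (h-semiconst x s _ p _ (≡ℕ-trans s≈r (replace-≡ℕ (evalList 𝐀 h ts r pr) r)))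

      evalList-freeze : (ts : List (HTerm τ X)) (r : Thread Carrier) .(pr : Trace.mem trace r) → s ≡ℕ r →
                        evalList 𝐀 h ts r pr ≡ evalList 𝐀 (freeze h s p) ts r pr
      evalList-freeze []       r pr s≈r = refl
      evalList-freeze (t ∷ ts) r pr s≈r = cong₂ _∷_ (eval-freeze t r pr s≈r) (evalList-freeze ts r pr s≈r)

  weakly⇒strongly : (u₁ u₂ : HTerm τ X) → WeaklySatisfies 𝐀 u₁ u₂ → StronglySatisfies 𝐀 u₁ u₂
  weakly⇒strongly u₁ u₂ weak h h-semiconst s p = begin
      eval 𝐀 h u₁ s p                  ≡⟨ eval-freeze h h-semiconst s p u₁ s p ≡ℕ-refl ⟩
      eval 𝐀 (freeze h s p) u₁ s p     ≡⟨ weak (freeze h s p) (freeze-constant h s p) s p ⟩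
      eval 𝐀 (freeze h s p) u₂ s p     ≡⟨ sym (eval-freeze h h-semiconst s p u₂ s p ≡ℕ-refl) ⟩
      eval 𝐀 h u₂ s p                  ∎
    where open ≡-Reasoning

  strongly⇒weakly : (u₁ u₂ : HTerm τ X) → StronglySatisfies 𝐀 u₁ u₂ → WeaklySatisfies 𝐀 u₁ u₂
  strongly⇒weakly u₁ u₂ strong h h-const = strong h (λ x → constant⇒semiconstant {a = trace} (h-const x))

proposition7p6 : {τ X : Set} (𝐀 : TAlgebra τ) → Infinite X → (u₁ u₂ : HTerm τ X)
    → (WeaklySatisfies 𝐀 u₁ u₂ → StronglySatisfies 𝐀 u₁ u₂)
    × (StronglySatisfies 𝐀 u₁ u₂ → WeaklySatisfies 𝐀 u₁ u₂)
proposition7p6 𝐀 _ u₁ u₂ = weakly⇒strongly 𝐀 u₁ u₂ , strongly⇒weakly 𝐀 u₁ u₂
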